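{- Let $n = 2q$ where $q>1$ is odd, and let $G = C_n(S)$ be a circulant graph with $S \subseteq \{1,\ldots,q\}$ that is not complete. Then $\omega(G) < q$ if and only if $\{2, 4, \ldots, q-1\} \not\subseteq S$.
   Context: For $S \subseteq \{1,\ldots,\lfloor n/2\rfloor\}$, the circulant graph $C_n(S)$ is the simple graph with vertex set $\mathbb{Z}_n=\{0,\ldots,n-1\}$ and edge set $\{\{i,j\} : |j-i|_n \in S\}$, where $|k|_n=\min\{|k|, n-|k|\}$. $\omega(G)$ denotes the maximum cardinality of a clique (set of pairwise adjacent vertices) of $G$. -}

module Defs where

open import Data.Nat using (ℕ; zero; suc; _+_; _*_; _∸_; _≤_; _<_; _⊓_; _≤ᵇ_)
open import Data.Bool using (if_then_else_)
open import Data.Fin using (Fin; toℕ; fromℕ<)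
open import Data.Fin.Subset using (Subset; _∈_; ∣_∣)
open import Data.Product using (Σ; ∃; _×_)
open import Relation.Binary.PropositionalEquality using (_≡_; _≢_)
open import Relation.Nullary using (¬_)

-- A subset S ⊆ {1,…,q} is represented as S : Subset (suc q) (a subset of
-- {0,…,q}) together with the hypothesis that 0 ∉ S.
Elem : ∀ {q} → Subset (suc q) → ℕ → Set
Elem {q} S d = Σ (d < suc q) (λ p → fromℕ< p ∈ S)

absDiff : ℕ → ℕ → ℕ
absDiff a b = if a ≤ᵇ b then b ∸ a else a ∸ b

circDist : (n : ℕ) → Fin n → Fin n → ℕ
circDist n i j = absDiff (toℕ i) (toℕ j) ⊓ (n ∸ absDiff (toℕ i) (toℕ j))

Adj : ∀ q → Subset (suc q) → Fin (2 * q) → Fin (2 * q) → Set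
Adj q S i j = Elem S (circDist (2 * q) i j)

IsComplete : ∀ q → Subset (suc q) → Set
IsComplete q S = ∀ (i j : Fin (2 * q)) → i ≢ j → Adj q S i j

IsClique : ∀ q → Subset (suc q) → Subset (2 * q) → Set
IsClique q S C = ∀ (i j : Fin (2 * q)) → i ∈ C → j ∈ C → i ≢ j → Adj q S i j

CliqueNumberLt : ∀ q → Subset (suc q) → ℕ → Set
CliqueNumberLt q S m = ∀ (C : Subset (2 * q)) → IsClique q S C → ∣ C ∣ < m

EvensIn : ∀ q → Subset (suc q) → Set
EvensIn q S = ∀ (k : ℕ) → 1 ≤ k → 2 * k ≤ q ∸ 1 → Elem S (2 * k)

-- If S contains every even d ≤ q − 1, the q even vertices form a
-- clique, since the circular distance of two of them is even and at most q, hence at most q − 1.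
-- Conversely, suppose an even d = 2k ≤ q − 1 is missing from S and C is a clique with |C| ≥ q.
-- Its indicator x on ℤ_n never has x i = x (i + d) = 1, so summing x i + x (i + d) ≤ 1 over ℤ_n
-- gives 2|C| ≤ n; equality forces x (i + d) = 1 − x i for every i. Then x has period 2d as
-- well as n, and since q·d = k·n is an odd multiple of d, x d = x 0, i.e. x 0 + x 0 = 1.

module Submission where

open import Defs
open import Data.Nat using (ℕ; suc; _*_; _<_; _+_)
open import Data.Fin using (zero)
open import Data.Fin.Subset using (Subset; _∉_)
open import Data.Product using (∃)
open import Relation.Binary.PropositionalEquality using (_≡_)
open import Relation.Nullary using (¬_)
open import Function.Bundles using (_⇔_)

open import Data.Nat.Base using (zero; _∸_; _≤_; _⊓_; _≤ᵇ_; ∣_-_∣; NonZero; z≤n; s≤s)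
open import Data.Nat.Properties
open import Data.Nat.DivMod using (_%_; _/_; m%n<n; m<n⇒m%n≡m; [m+n]%n≡m%n; m≡m%n+[m/n]*n; m≤n⇒[n∸m]%m≡n%m)
open import Data.Nat.Tactic.RingSolver using (solve-∀)
open import Algebra.Properties.CommutativeSemigroup +-commutativeSemigroup using (interchange; xy∙z≈xz∙y)
open import Data.Bool.Base using (Bool; true; false; T)
open import Data.Unit.Base using (tt)
open import Data.Empty using (⊥; ⊥-elim)
open import Data.Sum.Base using (_⊎_; inj₁; inj₂; [_,_]′)
open import Data.Product.Base using (_×_; _,_; proj₁; proj₂)
open import Data.Fin.Base using (Fin; toℕ; fromℕ<)
open import Data.Fin.Properties using (toℕ-fromℕ<; toℕ-injective; toℕ<n)
open import Data.Fin.Subset using (_∈_; ∣_∣)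
open import Data.Fin.Subset.Properties using (_∈?_)
open import Data.Vec.Base using ([]; _∷_; tabulate; here; there)
open import Data.Vec.Properties using ([]=⇒lookup; lookup∘tabulate)
open import Relation.Binary.PropositionalEquality using (refl; sym; trans; cong; cong₂; subst; _≢_; module ≡-Reasoning)
open import Relation.Nullary using (Dec; yes; no; ¬?)
open import Relation.Nullary.Decidable using (_×-dec_; decidable-stable)
open import Function.Base using (_∘_; case_of_)
open import Function.Bundles using (mk⇔)

sumTo : (ℕ → ℕ) → ℕ → ℕ
sumTo f zero    = 0
sumTo f (suc m) = sumTo f m + f m

sumTo-cong : ∀ {f g} m → (∀ {i} → i < m → f i ≡ g i) → sumTo f m ≡ sumTo g m
sumTo-cong zero    f≡g = refl
sumTo-cong (suc m) f≡g = cong₂ _+_ (sumTo-cong m (f≡g ∘ m<n⇒m<1+n)) (f≡g ≤-refl)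

sumTo-distrib-+ : ∀ f g m → sumTo (λ i → f i + g i) m ≡ sumTo f m + sumTo g m
sumTo-distrib-+ f g zero    = refl
sumTo-distrib-+ f g (suc m) =
  trans (cong (_+ (f m + g m)) (sumTo-distrib-+ f g m)) (interchange (sumTo f m) (sumTo g m) (f m) (g m))

sumTo-suc : ∀ f m → sumTo f (suc m) ≡ f 0 + sumTo (f ∘ suc) m
sumTo-suc f zero    = +-comm 0 (f 0)
sumTo-suc f (suc m) = trans (cong (_+ f (suc m)) (sumTo-suc f m)) (+-assoc (f 0) _ (f (suc m)))

sumTo-rotate : ∀ f m → f m ≡ f 0 → sumTo (f ∘ suc) m ≡ sumTo f m
sumTo-rotate f m fm≡f0 = +-cancelˡ-≡ (f 0) _ _ (begin
  f 0 + sumTo (f ∘ suc) m ≡⟨ sumTo-suc f m ⟨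
  sumTo f m + f m         ≡⟨ cong (sumTo f m +_) fm≡f0 ⟩
  sumTo f m + f 0         ≡⟨ +-comm (sumTo f m) (f 0) ⟩
  f 0 + sumTo f m         ∎)
  where open ≡-Reasoning

sumTo-≤ : ∀ f m → (∀ {i} → i < m → f i ≤ 1) → sumTo f m ≤ m
sumTo-≤ f zero    f≤1 = z≤n
sumTo-≤ f (suc m) f≤1 =
  subst (sumTo f m + f m ≤_) (+-comm m 1) (+-mono-≤ (sumTo-≤ f m (f≤1 ∘ m<n⇒m<1+n)) (f≤1 ≤-refl))

sumTo-≥⇒≡1 : ∀ f m → (∀ {i} → i < m → f i ≤ 1) → m ≤ sumTo f m → ∀ {i} → i < m → f i ≡ 1
sumTo-≥⇒≡1 f (suc m) f≤1 1+m≤Σ {i} i<1+m = case m<1+n⇒m<n∨m≡n i<1+m of λ where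
    (inj₁ i<m)  → sumTo-≥⇒≡1 f m (f≤1 ∘ m<n⇒m<1+n) m≤Σ i<m
    (inj₂ refl) → ≤-antisym (f≤1 ≤-refl) 1≤fm
  where
  m≤Σ : m ≤ sumTo f m
  m≤Σ = ≤-pred (≤-trans 1+m≤Σ (≤-trans (+-monoʳ-≤ (sumTo f m) (f≤1 ≤-refl)) (≤-reflexive (+-comm (sumTo f m) 1))))
  1≤fm : 1 ≤ f m
  1≤fm = +-cancelˡ-≤ m 1 (f m)
    (≤-trans (≤-reflexive (+-comm m 1)) (≤-trans 1+m≤Σ (+-monoˡ-≤ (f m) (sumTo-≤ f m (f≤1 ∘ m<n⇒m<1+n)))))

Periodic : (ℕ → ℕ) → ℕ → Set
Periodic f p = ∀ i → f (i + p) ≡ f i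

periodic-+* : ∀ {f p} → Periodic f p → ∀ i m → f (i + m * p) ≡ f i
periodic-+* {f} per i zero    = cong f (+-identityʳ i)
periodic-+* {f} {p} per i (suc m) = begin
  f (i + (p + m * p)) ≡⟨ cong f (+-assoc i p (m * p)) ⟨
  f (i + p + m * p)   ≡⟨ periodic-+* per (i + p) m ⟩
  f (i + p)           ≡⟨ per i ⟩
  f i                 ∎
  where open ≡-Reasoning

periodic-% : ∀ {f p} .{{_ : NonZero p}} → Periodic f p → ∀ i → f i ≡ f (i % p)
periodic-% {f} {p} per i = trans (cong f (m≡m%n+[m/n]*n i p)) (periodic-+* per (i % p) (i / p))

sumTo-shift : ∀ {f p} → Periodic f p → ∀ d → sumTo (λ i → f (i + d)) p ≡ sumTo f p
sumTo-shift {f} {p} per zero    = sumTo-cong p (λ {i} _ → cong f (+-identityʳ i))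
sumTo-shift {f} {p} per (suc d) = begin
  sumTo (λ i → f (i + suc d)) p ≡⟨ sumTo-cong p (λ {i} _ → cong f (+-suc i d)) ⟩
  sumTo (f+d ∘ suc) p           ≡⟨ sumTo-rotate f+d p (trans (cong f (+-comm p d)) (per d)) ⟩
  sumTo f+d p                   ≡⟨ sumTo-shift per d ⟩
  sumTo f p                     ∎
  where
  open ≡-Reasoning
  f+d : ℕ → ℕ
  f+d i = f (i + d)

-- Summing x i + x (i + d) over a period counts each value of x twice.
halfFull⇒complementary : ∀ {x n d} .{{_ : NonZero n}} → Periodic x n →
  (∀ {i} → i < n → x i + x (i + d) ≤ 1) → n ≤ sumTo x n + sumTo x n → ∀ i → x i + x (i + d) ≡ 1
halfFull⇒complementary {x} {n} {d} per g≤1 n≤2Σ i =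
  trans (periodic-% per-g i) (sumTo-≥⇒≡1 g n g≤1 n≤Σg (m%n<n i n))
  where
  g : ℕ → ℕ
  g i = x i + x (i + d)
  per-g : Periodic g n
  per-g i = cong₂ _+_ (per i) (trans (cong x (xy∙z≈xz∙y i n d)) (per (i + d)))
  n≤Σg : n ≤ sumTo g n
  n≤Σg = subst (n ≤_) (sym (trans (sumTo-distrib-+ x (λ i → x (i + d)) n) (cong (sumTo x n +_) (sumTo-shift per d)))) n≤2Σ

complementary⇒periodic : ∀ {x d} → (∀ i → x i + x (i + d) ≡ 1) → Periodic x (d + d)
complementary⇒periodic {x} {d} compl i = +-cancelˡ-≡ (x (i + d)) _ _ (begin
  x (i + d) + x (i + (d + d)) ≡⟨ cong (λ j → x (i + d) + x j) (+-assoc i d d) ⟨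
  x (i + d) + x (i + d + d)   ≡⟨ compl (i + d) ⟩
  1                           ≡⟨ compl i ⟨
  x i + x (i + d)             ≡⟨ +-comm (x i) (x (i + d)) ⟩
  x (i + d) + x i             ∎)
  where open ≡-Reasoning

-- Complementarity makes x alternate along steps of d, so x d = x ((1 + 2m) d) = x 0.
¬complementary-oddMultiple : ∀ {x n d} m j → Periodic x n →
  (∀ i → x i + x (i + d) ≡ 1) → (1 + 2 * m) * d ≡ j * n → ⊥
¬complementary-oddMultiple {x} {n} {d} m j per compl odd≡ = even≢odd (x 0) 0 (begin
  2 * x 0       ≡⟨ cong (x 0 +_) (+-identityʳ (x 0)) ⟩
  x 0 + x 0     ≡⟨ cong (x 0 +_) xd≡x0 ⟨
  x 0 + x (0 + d) ≡⟨ compl 0 ⟩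
  1             ∎)
  where
  open ≡-Reasoning
  xd≡x0 : x d ≡ x 0
  xd≡x0 = begin
    x d                 ≡⟨ periodic-+* {x} (complementary⇒periodic {x} compl) d m ⟨
    x (d + m * (d + d)) ≡⟨ cong x (trans (d+m*[d+d] m d) odd≡) ⟩
    x (0 + j * n)       ≡⟨ periodic-+* per 0 j ⟩
    x 0                 ∎
    where
    d+m*[d+d] : ∀ m d → d + m * (d + d) ≡ (1 + 2 * m) * d
    d+m*[d+d] = solve-∀

circNorm : ℕ → ℕ → ℕ
circNorm n δ = δ ⊓ (n ∸ δ)

circNorm-≤half : ∀ {n d} → d + d ≤ n → circNorm n d ≡ d
circNorm-≤half {d = d} d+d≤n = m≤n⇒m⊓n≡m (m+n≤o⇒m≤o∸n d d+d≤n)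

circNorm-∸ : ∀ {n d} → d ≤ n → circNorm n (n ∸ d) ≡ circNorm n d
circNorm-∸ {n} {d} d≤n = trans (cong ((n ∸ d) ⊓_) (m∸[m∸n]≡n d≤n)) (⊓-comm (n ∸ d) d)

circNorm-*ˡ : ∀ c n w → circNorm (c * n) (c * w) ≡ c * circNorm n w
circNorm-*ˡ c n w = begin
  (c * w) ⊓ (c * n ∸ c * w)   ≡⟨ cong ((c * w) ⊓_) (*-distribˡ-∸ c n w) ⟨
  (c * w) ⊓ (c * (n ∸ w))     ≡⟨ *-distribˡ-⊓ c w (n ∸ w) ⟨
  c * (w ⊓ (n ∸ w))           ∎
  where open ≡-Reasoning

circNorm-odd-bounds : ∀ {q w} k' → q ≡ 1 + 2 * k' → 0 < w → w < q →
  1 ≤ circNorm q w × 2 * circNorm q w ≤ q ∸ 1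
circNorm-odd-bounds {q} {w} k' refl 0<w w<q = ⊓-glb 0<w (m<n⇒0<n∸m w<q) , <⇒≤pred 2c<q
  where
  c : ℕ
  c = circNorm q w
  c+c≤q : c + c ≤ q
  c+c≤q = subst (c + c ≤_) (m+[n∸m]≡n (<⇒≤ w<q)) (+-mono-≤ (m⊓n≤m w (q ∸ w)) (m⊓n≤n w (q ∸ w)))
  2c<q : 2 * c < q
  2c<q = ≤∧≢⇒< (subst (_≤ q) (cong (c +_) (sym (+-identityʳ c))) c+c≤q) (even≢odd c k')

bit : Bool → ℕ
bit false = 0
bit true  = 1

bit+bit≤1 : ∀ a b → (T a → T b → ⊥) → bit a + bit b ≤ 1
bit+bit≤1 true  true  ¬both = ⊥-elim (¬both tt tt)
bit+bit≤1 true  false _     = ≤-refl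
bit+bit≤1 false false _     = z≤n
bit+bit≤1 false true  _     = ≤-refl

mem : ∀ {n} → Subset n → ℕ → Bool
mem []      i       = false
mem (b ∷ p) zero    = b
mem (b ∷ p) (suc i) = mem p i

mem⇒∈ : ∀ {n} (p : Subset n) {i} (i<n : i < n) → T (mem p i) → fromℕ< i<n ∈ p
mem⇒∈ (true ∷ p) {zero}  _          _ = here
mem⇒∈ (b ∷ p)    {suc i} (s≤s i<n) m = there (mem⇒∈ p i<n m)

mem-tabulate : ∀ {n} (f : Fin n → Bool) {i} (i<n : i < n) → mem (tabulate f) i ≡ f (fromℕ< i<n)
mem-tabulate {suc n} f {zero}  _         = refl
mem-tabulate {suc n} f {suc i} (s≤s i<n) = mem-tabulate (f ∘ Fin.suc) i<n

∣p∣≡sumTo-mem : ∀ {n} (p : Subset n) → ∣ p ∣ ≡ sumTo (bit ∘ mem p) n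
∣p∣≡sumTo-mem []              = refl
∣p∣≡sumTo-mem {suc n} (true ∷ p)  = trans (cong suc (∣p∣≡sumTo-mem p)) (sym (sumTo-suc (bit ∘ mem (true ∷ p)) n))
∣p∣≡sumTo-mem {suc n} (false ∷ p) = trans (∣p∣≡sumTo-mem p) (sym (sumTo-suc (bit ∘ mem (false ∷ p)) n))

cyclicIndicator : ∀ {n} .{{_ : NonZero n}} → Subset n → ℕ → ℕ
cyclicIndicator {n} p i = bit (mem p (i % n))

cyclicIndicator-periodic : ∀ {n} .{{_ : NonZero n}} (p : Subset n) → Periodic (cyclicIndicator p) n
cyclicIndicator-periodic {n} p i = cong (bit ∘ mem p) ([m+n]%n≡m%n i n)

sumTo-cyclicIndicator : ∀ {n} .{{_ : NonZero n}} (p : Subset n) → sumTo (cyclicIndicator p) n ≡ ∣ p ∣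
sumTo-cyclicIndicator {n} p =
  trans (sumTo-cong n (cong (bit ∘ mem p) ∘ m<n⇒m%n≡m)) (sym (∣p∣≡sumTo-mem p))

isEven : ℕ → Bool
isEven zero          = true
isEven (suc zero)    = false
isEven (suc (suc m)) = isEven m

isEven-2* : ∀ m → isEven (2 * m) ≡ true
isEven-2* zero    = refl
isEven-2* (suc m) = trans (cong isEven (*-suc 2 m)) (isEven-2* m)

isEven-1+2* : ∀ m → isEven (1 + 2 * m) ≡ false
isEven-1+2* zero    = refl
isEven-1+2* (suc m) = trans (cong (isEven ∘ suc) (*-suc 2 m)) (isEven-1+2* m)

isEven⇒2* : ∀ a → isEven a ≡ true → ∃ λ u → a ≡ 2 * u
isEven⇒2* zero          _       = 0 , refl
isEven⇒2* (suc (suc a)) a-even with isEven⇒2* a a-even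
... | u , refl = suc u , sym (*-suc 2 u)

sumTo-isEven : ∀ m → sumTo (bit ∘ isEven) (2 * m) ≡ m
sumTo-isEven zero    = refl
sumTo-isEven (suc m) = begin
  sumTo (bit ∘ isEven) (2 * suc m)                                 ≡⟨ cong (sumTo (bit ∘ isEven)) (*-suc 2 m) ⟩
  sumTo (bit ∘ isEven) (2 * m) + bit (isEven (2 * m)) + bit (isEven (1 + 2 * m))
    ≡⟨ cong₂ (λ b b′ → sumTo (bit ∘ isEven) (2 * m) + bit b + bit b′) (isEven-2* m) (isEven-1+2* m) ⟩
  sumTo (bit ∘ isEven) (2 * m) + 1 + 0                             ≡⟨ cong (λ s → s + 1 + 0) (sumTo-isEven m) ⟩
  m + 1 + 0                                                        ≡⟨ +-identityʳ (m + 1) ⟩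
  m + 1                                                            ≡⟨ +-comm m 1 ⟩
  suc m                                                            ∎
  where open ≡-Reasoning

absDiff≡∣-∣ : ∀ a b → absDiff a b ≡ ∣ a - b ∣
absDiff≡∣-∣ a b with a ≤ᵇ b in a≤ᵇb
... | true  = sym (m≤n⇒∣m-n∣≡n∸m (≤ᵇ⇒≤ a b (subst T (sym a≤ᵇb) tt)))
... | false = sym (m≤n⇒∣n-m∣≡n∸m {b} {a} (<⇒≤ (≰⇒> (λ a≤b → subst T a≤ᵇb (≤⇒≤ᵇ a≤b)))))

circDist≡circNorm : ∀ n (i j : Fin n) → circDist n i j ≡ circNorm n ∣ toℕ i - toℕ j ∣
circDist≡circNorm n i j = cong (circNorm n) (absDiff≡∣-∣ (toℕ i) (toℕ j))

circDist-self : ∀ n (i : Fin n) → circDist n i i ≡ 0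
circDist-self n i = trans (circDist≡circNorm n i i) (cong (circNorm n) (∣n-n∣≡0 (toℕ i)))

∣a-[a+d]%n∣ : ∀ {n a d} .{{_ : NonZero n}} → a < n → d ≤ n →
  ∣ a - (a + d) % n ∣ ≡ d ⊎ ∣ a - (a + d) % n ∣ ≡ n ∸ d
∣a-[a+d]%n∣ {n} {a} {d} a<n d≤n with a + d <? n
... | yes a+d<n = inj₁ (trans (cong ∣ a -_∣ (m<n⇒m%n≡m a+d<n)) (∣m-m+n∣≡n a d))
... | no  a+d≮n = inj₂ (begin
  ∣ a - (a + d) % n ∣     ≡⟨ cong₂ ∣_-_∣ a≡e+[n∸d] [a+d]%n≡e ⟩
  ∣ e + (n ∸ d) - e ∣     ≡⟨ ∣-∣-comm (e + (n ∸ d)) e ⟩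
  ∣ e - e + (n ∸ d) ∣     ≡⟨ ∣m-m+n∣≡n e (n ∸ d) ⟩
  n ∸ d                   ∎)
  where
  open ≡-Reasoning
  e : ℕ
  e = a + d ∸ n
  n≤a+d : n ≤ a + d
  n≤a+d = ≮⇒≥ a+d≮n
  e+n≡a+d : e + n ≡ a + d
  e+n≡a+d = m∸n+n≡m n≤a+d
  e<n : e < n
  e<n = +-cancelʳ-< n e n (subst (_< n + n) (sym e+n≡a+d) (+-mono-<-≤ a<n d≤n))
  [a+d]%n≡e : (a + d) % n ≡ e
  [a+d]%n≡e = trans (sym (m≤n⇒[n∸m]%m≡n%m n≤a+d)) (m<n⇒m%n≡m e<n)
  a≡e+[n∸d] : a ≡ e + (n ∸ d)
  a≡e+[n∸d] = begin
    a             ≡⟨ m+n∸n≡m a d ⟨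
    a + d ∸ d     ≡⟨ cong (_∸ d) e+n≡a+d ⟨
    e + n ∸ d     ≡⟨ +-∸-assoc e d≤n ⟩
    e + (n ∸ d)   ∎

circDist-shift : ∀ {n a d} .{{_ : NonZero n}} (a<n : a < n) → d + d ≤ n →
  circDist n (fromℕ< a<n) (fromℕ< (m%n<n (a + d) n)) ≡ d
circDist-shift {n} {a} {d} a<n d+d≤n = begin
  circDist n (fromℕ< a<n) (fromℕ< [a+d]%n<n)           ≡⟨ circDist≡circNorm n (fromℕ< a<n) (fromℕ< [a+d]%n<n) ⟩
  circNorm n ∣ toℕ (fromℕ< a<n) - toℕ (fromℕ< [a+d]%n<n) ∣
    ≡⟨ cong₂ (λ i j → circNorm n ∣ i - j ∣) (toℕ-fromℕ< a<n) (toℕ-fromℕ< [a+d]%n<n) ⟩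
  circNorm n ∣ a - (a + d) % n ∣
    ≡⟨ [ cong (circNorm n) , (λ δ≡n∸d → trans (cong (circNorm n) δ≡n∸d) (circNorm-∸ d≤n)) ]′ (∣a-[a+d]%n∣ a<n d≤n) ⟩
  circNorm n d                                          ≡⟨ circNorm-≤half d+d≤n ⟩
  d                                                     ∎
  where
  open ≡-Reasoning
  [a+d]%n<n : (a + d) % n < n
  [a+d]%n<n = m%n<n (a + d) n
  d≤n : d ≤ n
  d≤n = m+n≤o⇒n≤o d d+d≤n

clique-avoidsDistance : ∀ {q d} .{{_ : NonZero (2 * q)}} {S : Subset (suc q)} {C : Subset (2 * q)} →
  IsClique q S C → ¬ Elem S d → 0 < d → d + d ≤ 2 * q →
  ∀ {a} → a < 2 * q → cyclicIndicator C a + cyclicIndicator C (a + d) ≤ 1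
clique-avoidsDistance {q} {d} {S} {C} clique d∉S 0<d d+d≤n {a} a<n = bit+bit≤1 _ _ λ a∈C a+d∈C →
  d∉S (subst (Elem S) (circDist-shift a<n d+d≤n)
    (clique u v (mem⇒∈ C a<n (subst (T ∘ mem C) (m<n⇒m%n≡m a<n) a∈C)) (mem⇒∈ C (m%n<n (a + d) (2 * q)) a+d∈C) u≢v))
  where
  u v : Fin (2 * q)
  u = fromℕ< a<n
  v = fromℕ< (m%n<n (a + d) (2 * q))
  u≢v : u ≢ v
  u≢v u≡v = m<n⇒n≢0 0<d (begin
    d                    ≡⟨ circDist-shift a<n d+d≤n ⟨
    circDist (2 * q) u v ≡⟨ cong (circDist (2 * q) u) u≡v ⟨
    circDist (2 * q) u u ≡⟨ circDist-self (2 * q) u ⟩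
    0                    ∎)
    where open ≡-Reasoning

missingEven⇒cliqueNumber< : ∀ {q k} (S : Subset (suc q)) k' → q ≡ 1 + 2 * k' →
  1 ≤ k → 2 * k ≤ q ∸ 1 → ¬ Elem S (2 * k) → CliqueNumberLt q S q
missingEven⇒cliqueNumber< {k = k} S k' refl 1≤k d≤q∸1 d∉S C clique = ≰⇒> λ q≤∣C∣ →
  ¬complementary-oddMultiple k' k x-periodic
    (halfFull⇒complementary x-periodic (clique-avoidsDistance clique d∉S 0<d d+d≤n) (n≤Σx+Σx q≤∣C∣))
    (oddMultiple k' k)
  where
  q n d : ℕ
  q = 1 + 2 * k'
  n = 2 * q
  d = 2 * k
  x-periodic : Periodic (cyclicIndicator C) n
  x-periodic = cyclicIndicator-periodic C
  n≤Σx+Σx : q ≤ ∣ C ∣ → n ≤ sumTo (cyclicIndicator C) n + sumTo (cyclicIndicator C) n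
  n≤Σx+Σx q≤∣C∣ = subst (λ s → n ≤ s + s) (sym (sumTo-cyclicIndicator C))
    (+-mono-≤ q≤∣C∣ (≤-trans (≤-reflexive (+-identityʳ q)) q≤∣C∣))
  0<d : 0 < d
  0<d = ≤-trans 1≤k (m≤m+n k (k + 0))
  d≤q : d ≤ q
  d≤q = ≤-trans d≤q∸1 (m∸n≤m q 1)
  d+d≤n : d + d ≤ n
  d+d≤n = +-mono-≤ d≤q (≤-trans d≤q (≤-reflexive (sym (+-identityʳ q))))
  oddMultiple : ∀ k' k → (1 + 2 * k') * (2 * k) ≡ k * (2 * (1 + 2 * k'))
  oddMultiple = solve-∀

evenVertices : ∀ q → Subset (2 * q)
evenVertices q = tabulate (isEven ∘ toℕ)

∣evenVertices∣ : ∀ q → ∣ evenVertices q ∣ ≡ q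
∣evenVertices∣ q = begin
  ∣ evenVertices q ∣                      ≡⟨ ∣p∣≡sumTo-mem (evenVertices q) ⟩
  sumTo (bit ∘ mem (evenVertices q)) (2 * q) ≡⟨ sumTo-cong (2 * q) memEven ⟩
  sumTo (bit ∘ isEven) (2 * q)            ≡⟨ sumTo-isEven q ⟩
  q                                       ∎
  where
  open ≡-Reasoning
  memEven : ∀ {i} → i < 2 * q → bit (mem (evenVertices q) i) ≡ bit (isEven i)
  memEven i<2q = cong bit (trans (mem-tabulate (isEven ∘ toℕ) i<2q) (cong isEven (toℕ-fromℕ< i<2q)))

∈evenVertices⇒2* : ∀ {q} {i : Fin (2 * q)} → i ∈ evenVertices q → ∃ λ u → toℕ i ≡ 2 * u × u < q
∈evenVertices⇒2* {q} {i} i∈ with isEven⇒2* (toℕ i) (trans (sym (lookup∘tabulate (isEven ∘ toℕ) i)) ([]=⇒lookup i∈))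
... | u , i≡2u = u , i≡2u , *-cancelˡ-< 2 u q (subst (_< 2 * q) i≡2u (toℕ<n i))

evenVertices-isClique : ∀ {q} {S : Subset (suc q)} k' → q ≡ 1 + 2 * k' → EvensIn q S → IsClique q S (evenVertices q)
evenVertices-isClique {q} {S} k' q-odd evens i j i∈ j∈ i≢j with ∈evenVertices⇒2* {q} i∈ | ∈evenVertices⇒2* {q} j∈
... | u , i≡2u , u<q | v , j≡2v , v<q = subst (Elem S) (sym dist) (evens c 1≤c 2c≤q∸1)
  where
  w c : ℕ
  w = ∣ u - v ∣
  c = circNorm q w
  0<w : 0 < w
  0<w = n≢0⇒n>0 λ w≡0 → i≢j (toℕ-injective (trans i≡2u (trans (cong (2 *_) (∣m-n∣≡0⇒m≡n {u} {v} w≡0)) (sym j≡2v))))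
  w<q : w < q
  w<q = ≤-<-trans (∣m-n∣≤m⊔n u v) (⊔-lub u<q v<q)
  1≤c : 1 ≤ c
  1≤c = proj₁ (circNorm-odd-bounds k' q-odd 0<w w<q)
  2c≤q∸1 : 2 * c ≤ q ∸ 1
  2c≤q∸1 = proj₂ (circNorm-odd-bounds k' q-odd 0<w w<q)
  dist : circDist (2 * q) i j ≡ 2 * c
  dist = begin
    circDist (2 * q) i j                ≡⟨ circDist≡circNorm (2 * q) i j ⟩
    circNorm (2 * q) ∣ toℕ i - toℕ j ∣  ≡⟨ cong₂ (λ a b → circNorm (2 * q) ∣ a - b ∣) i≡2u j≡2v ⟩
    circNorm (2 * q) ∣ 2 * u - 2 * v ∣  ≡⟨ cong (circNorm (2 * q)) (*-distribˡ-∣-∣ 2 u v) ⟨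
    circNorm (2 * q) (2 * w)            ≡⟨ circNorm-*ˡ 2 q w ⟩
    2 * c                               ∎
    where open ≡-Reasoning

evensIn⇒¬cliqueNumber< : ∀ {q} {S : Subset (suc q)} k' → q ≡ 1 + 2 * k' → EvensIn q S → ¬ CliqueNumberLt q S q
evensIn⇒¬cliqueNumber< {q} k' q-odd evens ω<q =
  <-irrefl (∣evenVertices∣ q) (ω<q (evenVertices q) (evenVertices-isClique k' q-odd evens))

elem? : ∀ {q} (S : Subset (suc q)) d → Dec (Elem S d)
elem? {q} S d with d <? suc q
... | no  d≮1+q = no (d≮1+q ∘ proj₁)
... | yes d<1+q with fromℕ< d<1+q ∈? S
...   | yes d∈S = yes (d<1+q , d∈S)
...   | no  d∉S = no (d∉S ∘ proj₂)

¬evensIn⇒missingEven : ∀ {q} (S : Subset (suc q)) → ¬ EvensIn q S →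
  ∃ λ k → 1 ≤ k × 2 * k ≤ q ∸ 1 × ¬ Elem S (2 * k)
¬evensIn⇒missingEven {q} S ¬evens with anyUpTo? missing? (suc q)
  where
  missing? : ∀ k → Dec (1 ≤ k × 2 * k ≤ q ∸ 1 × ¬ Elem S (2 * k))
  missing? k = (1 ≤? k) ×-dec (2 * k ≤? q ∸ 1) ×-dec ¬? (elem? S (2 * k))
... | yes (k , _ , missing) = k , missing
... | no  none = ⊥-elim (¬evens λ k 1≤k 2k≤q∸1 → decidable-stable (elem? S (2 * k)) λ 2k∉S →
  none (k , s≤s (≤-trans (m≤m+n k (k + 0)) (≤-trans 2k≤q∸1 (m∸n≤m q 1))) , 1≤k , 2k≤q∸1 , 2k∉S))

lemma2p4 : (q : ℕ) → (∃ λ k → q ≡ 1 + 2 * k) → 1 < q →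
    (S : Subset (suc q)) → zero ∉ S → ¬ IsComplete q S →
    CliqueNumberLt q S q ⇔ (¬ EvensIn q S)
lemma2p4 q (k' , q-odd) _ S _ _ = mk⇔
  (λ ω<q evens → evensIn⇒¬cliqueNumber< k' q-odd evens ω<q)
  (λ ¬evens → let k , 1≤k , 2k≤q∸1 , 2k∉S = ¬evensIn⇒missingEven S ¬evens
              in missingEven⇒cliqueNumber< S k' q-odd 1≤k 2k≤q∸1 2k∉S)
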